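{- Let $n\ge4$ and $\pi\in K_n$. The following are equivalent: (1) there exist $k$, permutations $\pi^1,\dots,\pi^k\in\{[3142],[2413]\}$ and $\pi'\in S_k$ such that $\pi=\pi'[\pi^1,\dots,\pi^k]$; (2) for each $i\in\{1,\dots,n\}$, the permutation obtained from $\pi$ by removing the value $i$ and standardizing contains a block of length $3$; (3) $\pi$ has no princes.
   Context: $K_n$ is the set of permutations $\sigma\in S_n$ (one-line notation $[\sigma_1,\dots,\sigma_n]$) with $|\sigma_i-\sigma_{i-1}|\neq1$ for all $2\le i\le n$. $\pi\preceq\sigma$ means some subsequence of $\sigma$ is order-isomorphic to $\pi$; $\pi\prec\sigma$ means $\pi\preceq\sigma$, $\pi\ne\sigma$. A prince of $\sigma\in K_n$ is a $\tau\in K_{n-1}$ with $\tau\prec\sigma$. A block of length $k$ of a permutation is a sequence of $k$ entries in consecutive positions whose values form a set of $k$ consecutive integers. Inflation: for $\pi\in S_k$ and $\alpha^i\in S_{n_i}$ ($1\le i\le k$) with $n=n_1+\dots+n_k$, $\pi[\alpha^1,\dots,\alpha^k]\in S_n$ is obtained by replacing the $i$-th entry of $\pi$ by a contiguous sequence of entries order-isomorphic to $\alpha^i$ whose values form a set of $n_i$ consecutive integers, these value sets being ordered relative to each other as the entries of $\pi$ are (so, in the order of $\pi$'s values, the value set of the block replacing the entry of value $v$ is $\{s_v+1,\dots,s_v+n_{\pi^{ -1}(v)}\}$ where $s_v$ is the sum of the sizes of blocks replacing entries of value less than $v$). -}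

module Defs where

open import Data.Nat using (ℕ; zero; suc; _+_; _<_; _<ᵇ_; _≟_; _<?_)
open import Data.List using (List; []; _∷_; _++_; length; map; filter; upTo; concat; zipWith; [_])
open import Data.Nat.ListAction using (sum)
open import Data.List.Relation.Binary.Permutation.Propositional using (_↭_)
open import Data.List.Relation.Binary.Sublist.Propositional using (_⊆_)
open import Data.List.Relation.Unary.All using (All)
open import Data.Bool using (if_then_else_)
open import Data.Product using (_×_; ∃; ∃-syntax; Σ-syntax)
open import Data.Sum using (_⊎_)
open import Data.Unit using (⊤)
open import Relation.Nullary using (¬_; ¬?)
open import Relation.Binary.PropositionalEquality using (_≡_; _≢_)

-- Permutations in one-line notation, 0-INDEXED: a permutation of size n is a
-- list of length n that is a rearrangement of [0, 1, …, n-1].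
IsPerm : List ℕ → Set
IsPerm σ = σ ↭ upTo (length σ)

NoAdj : List ℕ → Set
NoAdj [] = ⊤
NoAdj (x ∷ []) = ⊤
NoAdj (x ∷ y ∷ xs) = ¬ (suc x ≡ y ⊎ suc y ≡ x) × NoAdj (y ∷ xs)

K : ℕ → List ℕ → Set
K n σ = length σ ≡ n × IsPerm σ × NoAdj σ

std : List ℕ → List ℕ
std xs = map (λ x → length (filter (_<? x) xs)) xs

_⪯_ : List ℕ → List ℕ → Set
π ⪯ σ = ∃[ s ] (s ⊆ σ × std s ≡ std π)

_≺_ : List ℕ → List ℕ → Set
π ≺ σ = π ⪯ σ × π ≢ σ

Prince : ℕ → List ℕ → List ℕ → Set
Prince n τ σ = K (n Data.Nat.∸ 1) τ × τ ≺ σ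

HasBlock : ℕ → List ℕ → Set
HasBlock k σ = ∃[ a ] ∃[ b ] ∃[ c ] ∃[ m ]
  (σ ≡ a ++ b ++ c × length b ≡ k × b ↭ map (m +_) (upTo k))

removeVal : ℕ → List ℕ → List ℕ
removeVal i σ = filter (λ x → ¬? (x ≟ i)) σ

-- inflation π[α¹,…,αᵏ]: the block replacing the entry of value v is shifted by
-- the total size of blocks replacing entries of value less than v
offset : List ℕ → List (List ℕ) → ℕ → ℕ
offset π αs v = sum (zipWith (λ w α → if w <ᵇ v then length α else 0) π αs)

inflate : List ℕ → List (List ℕ) → List ℕ
inflate π αs = concat (zipWith (λ v α → map (offset π αs v +_) α) π αs)

p3142 : List ℕ
p3142 = 2 ∷ 0 ∷ 3 ∷ 1 ∷ []

p2413 : List ℕ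
p2413 = 1 ∷ 3 ∷ 0 ∷ 2 ∷ []

Cond1 : List ℕ → Set
Cond1 π = ∃[ k ] ∃[ πs ] ∃[ π' ]
  ( length πs ≡ k
  × All (λ p → p ≡ p3142 ⊎ p ≡ p2413) πs
  × length π' ≡ k × IsPerm π'
  × π ≡ inflate π' πs )

Cond2 : ℕ → List ℕ → Set
Cond2 n π = ∀ i → i < n → HasBlock 3 (std (removeVal i π))

Cond3 : ℕ → List ℕ → Set
Cond3 n π = ¬ (∃[ τ ] Prince n τ π)

module Submission where

-- (1) ⇒ (2): deleting a value of π = π′[π¹, …, πᵏ] deletes it from one inflated copy
-- of 3142 or 2413, which then standardizes to a block of three consecutive values.
-- (2) ⇒ (3): a prince is the standardization of π with one value deleted, and a block
-- of three consecutive values always has two consecutive values next to each other.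
-- (3) ⇒ (1): since deleting π_q gives no prince, it creates an adjacency: either the
-- neighbours π_{q-1}, π_{q+1} are consecutive, or π_q - 1 and π_q + 1 sit side by side
-- ("q is bridged"). Scanning π from the left, the value at the start s of the next
-- block is bridged by a pair to its right, and chasing the bridges of that pair forces
-- positions s, …, s + 3 to carry 2413 (ascending pair) or 3142 (descending pair, the
-- complement of the ascending case). The value sets of these blocks are intervals of
-- length 4 tiling [0, n), so their offsets are 4 π′ for a permutation π′.

open import Defs
open import Data.Nat using (ℕ; zero; suc; _+_; _*_; _∸_; _⊓_; _≤_; _<_; z≤n; s≤s; _≟_; _<?_; _<ᵇ_; pred)
open import Data.Nat.Properties
open import Data.Nat.DivMod using (_/_; m*n/n≡m)
open import Data.Bool using (true; false)
open import Data.List using (List; []; _∷_; _++_; [_]; length; map; filter; upTo; concat; zipWith; drop)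
open import Data.List.Properties
  using (length-upTo; upTo-∷ʳ; filter-++; filter-accept; filter-reject; length-++; length-++-sucʳ; length-map; map-++; map-∘;
         map-cong; map-cong-local; map-id-local; ++-assoc; ++-identityʳ; concat-++; drop-all)
open import Data.List.Membership.Propositional using (_∈_; _∉_)
open import Data.List.Membership.Propositional.Properties
  using (∈-upTo⁺; ∈-upTo⁻; ∈-++⁻; ∈-++⁺ˡ; ∈-++⁺ʳ; ∈-map⁺; ∈-map⁻; ∈-∃++; ∈-filter⁻;
         ∈-concat⁺′; ∈-concat⁻′)
open import Data.List.Relation.Unary.Any using (here; there)
import Data.List.Relation.Unary.All as All
open All using (All; []; _∷_; tabulate; lookup)
import Data.List.Relation.Unary.All.Properties as AllP
open import Data.List.Relation.Unary.AllPairs using ([]; _∷_)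
open import Data.List.Relation.Unary.Unique.Propositional using (Unique)
import Data.List.Relation.Unary.Unique.Propositional.Properties as UniqueP
open UniqueP using (upTo⁺)
open import Data.List.Relation.Binary.Sublist.Propositional using (_⊆_; []; _∷_; _∷ʳ_)
open import Data.List.Relation.Binary.Sublist.Propositional.Properties using (length-mono-≤; filter-⊆)
open import Data.List.Relation.Binary.Permutation.Propositional
  using (_↭_; refl; prep; swap; trans; ↭-sym; module PermutationReasoning)
open import Data.List.Relation.Binary.Permutation.Propositional.Properties
  using (All-resp-↭; ∈-resp-↭; ↭-length; filter-↭; map⁺; ++⁺; drop-∷; shift; shifts; ++-comm; ∷↭∷ʳ)
open import Data.Product using (_×_; _,_; proj₁; proj₂; ∃-syntax)
import Data.Sum as Sum
open Sum using (_⊎_; inj₁; inj₂)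
open import Data.Unit using (tt)
open import Function.Base using (_∘′_)
open import Function.Bundles using (_⇔_; mk⇔)
open import Relation.Binary.Definitions using (Tri; tri<; tri≈; tri>)
open import Relation.Nullary using (¬_; Dec; yes; no; ¬?; contradiction)
open import Relation.Nullary.Decidable using (_⊎-dec_; _×-dec_)
open import Relation.Binary.PropositionalEquality
  using (_≡_; _≢_; refl; sym; cong; cong₂; subst; subst₂; module ≡-Reasoning)
  renaming (trans to ≡-trans)

Consecutive : ℕ → ℕ → Set
Consecutive a b = suc a ≡ b ⊎ suc b ≡ a

Between : ℕ → ℕ → ℕ → Set
Between a b c = (suc a ≡ c × suc c ≡ b) ⊎ (suc b ≡ c × suc c ≡ a)

Consecutive-sym : ∀ {a b} → Consecutive a b → Consecutive b a
Consecutive-sym (inj₁ e) = inj₂ e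
Consecutive-sym (inj₂ e) = inj₁ e

Consecutive? : ∀ a b → Dec (Consecutive a b)
Consecutive? a b = (suc a ≟ b) ⊎-dec (suc b ≟ a)

Between? : ∀ a b c → Dec (Between a b c)
Between? a b c = ((suc a ≟ c) ×-dec (suc c ≟ b)) ⊎-dec ((suc b ≟ c) ×-dec (suc c ≟ a))

Between⇒Consecutive : ∀ {a b c} → Between a b c → Consecutive a c
Between⇒Consecutive (inj₁ (e , _)) = inj₁ e
Between⇒Consecutive (inj₂ (_ , e)) = inj₂ e

at : List ℕ → ℕ → ℕ
at []       _       = 0
at (x ∷ xs) zero    = x
at (x ∷ xs) (suc i) = at xs i

at-∈ : ∀ xs {i} → i < length xs → at xs i ∈ xs
at-∈ (x ∷ xs) {zero}  _         = here refl
at-∈ (x ∷ xs) {suc i} (s≤s i<) = there (at-∈ xs i<)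

∈⇒at : ∀ {xs x} → x ∈ xs → ∃[ i ] i < length xs × at xs i ≡ x
∈⇒at (here refl) = 0 , s≤s z≤n , refl
∈⇒at (there x∈) with ∈⇒at x∈
... | i , i< , e = suc i , s≤s i< , e

at-injective : ∀ xs → Unique xs → ∀ {i j} → i < length xs → j < length xs → at xs i ≡ at xs j → i ≡ j
at-injective (x ∷ xs) _         {zero}  {zero}  _         _         _ = refl
at-injective (x ∷ xs) (x∉ ∷ _)  {zero}  {suc j} _         (s≤s j<) e = contradiction e (lookup x∉ (at-∈ xs j<))
at-injective (x ∷ xs) (x∉ ∷ _)  {suc i} {zero}  (s≤s i<) _         e = contradiction (sym e) (lookup x∉ (at-∈ xs i<))
at-injective (x ∷ xs) (_ ∷ uxs) {suc i} {suc j} (s≤s i<) (s≤s j<) e = cong suc (at-injective xs uxs i< j< e)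

at-map : ∀ (f : ℕ → ℕ) xs {i} → i < length xs → at (map f xs) i ≡ f (at xs i)
at-map f (x ∷ xs) {zero}  _         = refl
at-map f (x ∷ xs) {suc i} (s≤s i<) = at-map f xs i<

at-split : ∀ xs {q} → q < length xs → ∃[ L ] ∃[ R ] xs ≡ L ++ at xs q ∷ R × length L ≡ q
at-split (x ∷ xs) {zero}  _         = [] , xs , refl , refl
at-split (x ∷ xs) {suc q} (s≤s q<) with at-split xs q<
... | L , R , e , ∣L∣ = x ∷ L , R , cong (x ∷_) e , cong suc ∣L∣

at-++-∷-below : ∀ L v R {i} → i < length L → at (L ++ R) i ≡ at (L ++ v ∷ R) i
at-++-∷-below (x ∷ L) v R {zero}  _         = refl
at-++-∷-below (x ∷ L) v R {suc i} (s≤s i<) = at-++-∷-below L v R i<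

at-++-∷-above : ∀ L v R {i} → length L ≤ i → at (L ++ R) i ≡ at (L ++ v ∷ R) (suc i)
at-++-∷-above []      v R         _         = refl
at-++-∷-above (x ∷ L) v R {suc i} (s≤s ≤i) = at-++-∷-above L v R ≤i

drop-at : ∀ xs {s} → s < length xs → drop s xs ≡ at xs s ∷ drop (suc s) xs
drop-at (x ∷ xs) {zero}  _         = refl
drop-at (x ∷ xs) {suc s} (s≤s s<) = drop-at xs s<

NoAdj⇒apart : ∀ xs → NoAdj xs → ∀ {i} → suc i < length xs → ¬ Consecutive (at xs i) (at xs (suc i))
NoAdj⇒apart (x ∷ [])     _           {_}     (s≤s ())
NoAdj⇒apart (x ∷ y ∷ xs) (apart , _) {zero}  _         = apart
NoAdj⇒apart (x ∷ y ∷ xs) (_ , rest)  {suc i} (s≤s i<) = NoAdj⇒apart (y ∷ xs) rest i<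

apart⇒NoAdj : ∀ xs → (∀ {i} → suc i < length xs → ¬ Consecutive (at xs i) (at xs (suc i))) → NoAdj xs
apart⇒NoAdj []           _     = tt
apart⇒NoAdj (x ∷ [])     _     = tt
apart⇒NoAdj (x ∷ y ∷ xs) apart = apart (s≤s (s≤s z≤n)) , apart⇒NoAdj (y ∷ xs) (λ i< → apart (s≤s i<))

NoAdj-++⁻ʳ : ∀ xs {ys} → NoAdj (xs ++ ys) → NoAdj ys
NoAdj-++⁻ʳ []           na       = na
NoAdj-++⁻ʳ (x ∷ [])     {[]}     _        = tt
NoAdj-++⁻ʳ (x ∷ [])     {y ∷ ys} (_ , na) = na
NoAdj-++⁻ʳ (x ∷ y ∷ xs) (_ , na) = NoAdj-++⁻ʳ (y ∷ xs) na

Unique-resp-↭ : ∀ {xs ys : List ℕ} → xs ↭ ys → Unique xs → Unique ys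
Unique-resp-↭ refl           u                          = u
Unique-resp-↭ (prep x p)     (x∉ ∷ u)                   = All-resp-↭ p x∉ ∷ Unique-resp-↭ p u
Unique-resp-↭ (swap x y p)   ((x≢y ∷ x∉) ∷ (y∉ ∷ u))    =
  ((λ e → x≢y (sym e)) ∷ All-resp-↭ p y∉) ∷ (All-resp-↭ p x∉ ∷ Unique-resp-↭ p u)
Unique-resp-↭ (trans p q)    u                          = Unique-resp-↭ q (Unique-resp-↭ p u)

Unique-middle : ∀ (L : List ℕ) v R → Unique (L ++ v ∷ R) → v ∉ L × v ∉ R
Unique-middle []      v R (v∉ ∷ _) = (λ ()) , λ v∈ → lookup v∉ v∈ refl
Unique-middle (x ∷ L) v R (x∉ ∷ u) with Unique-middle L v R u
... | v∉L , v∉R = (λ { (here refl) → lookup x∉ (∈-++⁺ʳ L (here refl)) refl ; (there v∈) → v∉L v∈ }) , v∉R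

-- Deleting a value and standardizing

closeGap : ℕ → ℕ → ℕ
closeGap v x with v <? x
... | yes _ = pred x
... | no  _ = x

closeGap-> : ∀ {v x} → v < x → closeGap v x ≡ pred x
closeGap-> {v} {x} v<x with v <? x
... | yes _   = refl
... | no  v≮x = contradiction v<x v≮x

closeGap-≤ : ∀ {v x} → x ≤ v → closeGap v x ≡ x
closeGap-≤ {v} {x} x≤v with v <? x
... | yes v<x = contradiction x≤v (<⇒≱ v<x)
... | no  _   = refl

closeGap-+ : ∀ o v x → closeGap (o + v) (o + x) ≡ o + closeGap v x
closeGap-+ o v x = go (v <? x)
  where
  pred-+ : ∀ {y} → v < y → pred (o + y) ≡ o + pred y
  pred-+ {suc y} _ = cong pred (+-suc o y)
  go : Dec (v < x) → closeGap (o + v) (o + x) ≡ o + closeGap v x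
  go (yes v<x) = ≡-trans (closeGap-> (+-monoʳ-< o v<x)) (≡-trans (pred-+ v<x) (cong (o +_) (sym (closeGap-> v<x))))
  go (no  v≮x) = ≡-trans (closeGap-≤ (+-monoʳ-≤ o (≮⇒≥ v≮x))) (cong (o +_) (sym (closeGap-≤ (≮⇒≥ v≮x))))

closeGap-consecutive : ∀ {v a b} → a ≢ v → b ≢ v → Consecutive (closeGap v a) (closeGap v b) →
  Consecutive a b ⊎ Between a b v
closeGap-consecutive {v} {a} {b} a≢v b≢v c with <-cmp a v | <-cmp b v
... | tri≈ _ a≡v _ | _            = contradiction a≡v a≢v
... | _            | tri≈ _ b≡v _ = contradiction b≡v b≢v
... | tri< a<v _ _ | tri< b<v _ _ rewrite closeGap-≤ (<⇒≤ a<v) | closeGap-≤ (<⇒≤ b<v) = inj₁ c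
closeGap-consecutive {v} {suc a} {suc b} _ _ c | tri> _ _ v<a | tri> _ _ v<b
  rewrite closeGap-> v<a | closeGap-> v<b = inj₁ (Sum.map (cong suc) (cong suc) c)
closeGap-consecutive {v} {a} {suc b} _ _ c | tri< a<v _ _ | tri> _ _ v<b
  rewrite closeGap-≤ (<⇒≤ a<v) | closeGap-> v<b with c
... | inj₁ refl = let a+1≡v = ≤-antisym a<v (≤-pred v<b) in inj₂ (inj₁ (a+1≡v , cong suc (sym a+1≡v)))
... | inj₂ refl = contradiction (<-trans a<v v<b) (n≮n _)
closeGap-consecutive {v} {suc a} {b} _ _ c | tri> _ _ v<a | tri< b<v _ _
  rewrite closeGap-> v<a | closeGap-≤ (<⇒≤ b<v) with c
... | inj₂ refl = let b+1≡v = ≤-antisym b<v (≤-pred v<a) in inj₂ (inj₂ (b+1≡v , cong suc (sym b+1≡v)))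
... | inj₁ refl = contradiction (<-trans b<v v<a) (n≮n _)

removeVal-∷-≡ : ∀ v xs → removeVal v (v ∷ xs) ≡ removeVal v xs
removeVal-∷-≡ v xs = filter-reject (λ x → ¬? (x ≟ v)) (λ v≢v → v≢v refl)

removeVal-∷-≢ : ∀ {v x} xs → x ≢ v → removeVal v (x ∷ xs) ≡ x ∷ removeVal v xs
removeVal-∷-≢ {v} xs x≢v = filter-accept (λ x → ¬? (x ≟ v)) x≢v

removeVal-∉ : ∀ v xs → v ∉ xs → removeVal v xs ≡ xs
removeVal-∉ v []       _  = refl
removeVal-∉ v (x ∷ xs) v∉ =
  ≡-trans (removeVal-∷-≢ xs (λ x≡v → v∉ (here (sym x≡v)))) (cong (x ∷_) (removeVal-∉ v xs (v∉ ∘′ there)))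

removeVal-++ : ∀ v xs ys → removeVal v (xs ++ ys) ≡ removeVal v xs ++ removeVal v ys
removeVal-++ v = filter-++ (λ x → ¬? (x ≟ v))

removeVal-middle : ∀ L v R → Unique (L ++ v ∷ R) → removeVal v (L ++ v ∷ R) ≡ L ++ R
removeVal-middle L v R u with Unique-middle L v R u
... | v∉L , v∉R = begin
  removeVal v (L ++ v ∷ R)             ≡⟨ removeVal-++ v L (v ∷ R) ⟩
  removeVal v L ++ removeVal v (v ∷ R) ≡⟨ cong (removeVal v L ++_) (removeVal-∷-≡ v R) ⟩
  removeVal v L ++ removeVal v R       ≡⟨ cong₂ _++_ (removeVal-∉ v L v∉L) (removeVal-∉ v R v∉R) ⟩
  L ++ R                               ∎
  where open ≡-Reasoning

removeVal-+ : ∀ o v xs → removeVal (o + v) (map (o +_) xs) ≡ map (o +_) (removeVal v xs)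
removeVal-+ o v [] = refl
removeVal-+ o v (x ∷ xs) with x ≟ v
... | yes refl = ≡-trans (removeVal-∷-≡ (o + x) _)
                  (≡-trans (removeVal-+ o x xs) (cong (map (o +_)) (sym (removeVal-∷-≡ x xs))))
... | no  x≢v  = ≡-trans (removeVal-∷-≢ _ (x≢v ∘′ +-cancelˡ-≡ o x v))
                  (≡-trans (cong (o + x ∷_) (removeVal-+ o v xs)) (cong (map (o +_)) (sym (removeVal-∷-≢ xs x≢v))))

filter-comm : ∀ {P Q : ℕ → Set} (P? : ∀ x → Dec (P x)) (Q? : ∀ x → Dec (Q x)) xs →
  filter P? (filter Q? xs) ≡ filter Q? (filter P? xs)
filter-comm P? Q? []       = refl
filter-comm {P} {Q} P? Q? (x ∷ xs) = step (P? x) (Q? x)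
  where
  step : Dec (P x) → Dec (Q x) → filter P? (filter Q? (x ∷ xs)) ≡ filter Q? (filter P? (x ∷ xs))
  step (yes p) (yes q) rewrite filter-accept Q? {xs = xs} q | filter-accept P? {xs = filter Q? xs} p
                             | filter-accept P? {xs = xs} p | filter-accept Q? {xs = filter P? xs} q =
    cong (x ∷_) (filter-comm P? Q? xs)
  step (yes p) (no ¬q) rewrite filter-reject Q? {xs = xs} ¬q | filter-accept P? {xs = xs} p
                             | filter-reject Q? {xs = filter P? xs} ¬q = filter-comm P? Q? xs
  step (no ¬p) (yes q) rewrite filter-accept Q? {xs = xs} q | filter-reject P? {xs = filter Q? xs} ¬p
                             | filter-reject P? {xs = xs} ¬p = filter-comm P? Q? xs
  step (no ¬p) (no ¬q) rewrite filter-reject Q? {xs = xs} ¬q | filter-reject P? {xs = xs} ¬p = filter-comm P? Q? xs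

filter-<-upTo : ∀ x n → filter (_<? x) (upTo n) ≡ upTo (x ⊓ n)
filter-<-upTo x zero    = cong upTo (sym (⊓-zeroʳ x))
filter-<-upTo x (suc n) = begin
  filter (_<? x) (upTo (suc n))                    ≡⟨ cong (filter (_<? x)) (sym (upTo-∷ʳ n)) ⟩
  filter (_<? x) (upTo n ++ [ n ])                 ≡⟨ filter-++ (_<? x) (upTo n) [ n ] ⟩
  filter (_<? x) (upTo n) ++ filter (_<? x) [ n ]  ≡⟨ cong (_++ filter (_<? x) [ n ]) (filter-<-upTo x n) ⟩
  upTo (x ⊓ n) ++ filter (_<? x) [ n ]             ≡⟨ last (n <? x) ⟩
  upTo (x ⊓ suc n)                                 ∎
  where
  open ≡-Reasoning
  last : Dec (n < x) → upTo (x ⊓ n) ++ filter (_<? x) [ n ] ≡ upTo (x ⊓ suc n)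
  last (yes n<x) rewrite filter-accept (_<? x) {xs = []} n<x | m≥n⇒m⊓n≡n (<⇒≤ n<x) | m≥n⇒m⊓n≡n n<x =
    upTo-∷ʳ n
  last (no  n≮x) rewrite filter-reject (_<? x) {xs = []} n≮x | m≤n⇒m⊓n≡m (≮⇒≥ n≮x)
                       | m≤n⇒m⊓n≡m (m≤n⇒m≤1+n (≮⇒≥ n≮x)) = ++-identityʳ (upTo x)

filter-<-upTo-≤ : ∀ {x} n → x ≤ n → filter (_<? x) (upTo n) ≡ upTo x
filter-<-upTo-≤ {x} n x≤n = ≡-trans (filter-<-upTo x n) (cong upTo (m≤n⇒m⊓n≡m x≤n))

length-removeVal-upTo : ∀ v x → length (removeVal v (upTo x)) ≡ closeGap v x
length-removeVal-upTo v zero    = sym (closeGap-≤ {v} z≤n)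
length-removeVal-upTo v (suc x) = begin
  length (removeVal v (upTo (suc x)))
    ≡⟨ cong (length ∘′ removeVal v) (sym (upTo-∷ʳ x)) ⟩
  length (removeVal v (upTo x ++ [ x ]))
    ≡⟨ cong length (removeVal-++ v (upTo x) [ x ]) ⟩
  length (removeVal v (upTo x) ++ removeVal v [ x ])
    ≡⟨ length-++ (removeVal v (upTo x)) ⟩
  length (removeVal v (upTo x)) + length (removeVal v [ x ])
    ≡⟨ cong (_+ length (removeVal v [ x ])) (length-removeVal-upTo v x) ⟩
  closeGap v x + length (removeVal v [ x ])
    ≡⟨ last (<-cmp v x) ⟩
  closeGap v (suc x)
    ∎
  where
  open ≡-Reasoning
  last : Tri (v < x) (v ≡ x) (x < v) → closeGap v x + length (removeVal v [ x ]) ≡ closeGap v (suc x)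
  last (tri< v<x@(s≤s _) _ _)
    rewrite closeGap-> v<x | closeGap-> (m<n⇒m<1+n v<x) | removeVal-∷-≢ [] (>⇒≢ v<x) = +-comm _ 1
  last (tri≈ _ refl _)
    rewrite closeGap-≤ (≤-refl {v}) | closeGap-> (n<1+n v) | removeVal-∷-≡ v [] = +-identityʳ v
  last (tri> _ _ x<v)
    rewrite closeGap-≤ (<⇒≤ x<v) | closeGap-≤ x<v | removeVal-∷-≢ [] (<⇒≢ x<v) = +-comm x 1

count-<-↭ : ∀ {xs ys : List ℕ} x → xs ↭ ys → length (filter (_<? x) xs) ≡ length (filter (_<? x) ys)
count-<-↭ x p = ↭-length (filter-↭ (_<? x) p)

std-↭-upTo : ∀ {τ} m → τ ↭ upTo m → std τ ≡ τ
std-↭-upTo {τ} m p = map-id-local (tabulate λ {x} x∈ → begin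
  length (filter (_<? x) τ)        ≡⟨ count-<-↭ x p ⟩
  length (filter (_<? x) (upTo m)) ≡⟨ cong length (filter-<-upTo-≤ m (<⇒≤ (∈-upTo⁻ (∈-resp-↭ p x∈)))) ⟩
  length (upTo x)                  ≡⟨ length-upTo x ⟩
  x                                ∎)
  where open ≡-Reasoning

std-removeVal : ∀ {π} n v → π ↭ upTo n → std (removeVal v π) ≡ map (closeGap v) (removeVal v π)
std-removeVal {π} n v p = map-cong-local (tabulate λ {x} x∈ → begin
  length (filter (_<? x) (removeVal v π))         ≡⟨ count-<-↭ x (filter-↭ (λ y → ¬? (y ≟ v)) p) ⟩
  length (filter (_<? x) (removeVal v (upTo n)))  ≡⟨ cong length (filter-comm (_<? x) (λ y → ¬? (y ≟ v)) (upTo n)) ⟩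
  length (removeVal v (filter (_<? x) (upTo n)))  ≡⟨ cong (length ∘′ removeVal v) (filter-<-upTo-≤ n (<⇒≤ (x<n x∈))) ⟩
  length (removeVal v (upTo x))                   ≡⟨ length-removeVal-upTo v x ⟩
  closeGap v x                                    ∎)
  where
  open ≡-Reasoning
  x<n : ∀ {x} → x ∈ removeVal v π → x < n
  x<n x∈ = ∈-upTo⁻ (∈-resp-↭ p (proj₁ (∈-filter⁻ (λ y → ¬? (y ≟ v)) x∈)))

closeGap-removeVal-upTo : ∀ {v} n → v < n → map (closeGap v) (removeVal v (upTo n)) ≡ upTo (pred n)
closeGap-removeVal-upTo {v} (suc m) v<1+m = begin
  map (closeGap v) (removeVal v (upTo (suc m)))
    ≡⟨ cong (map (closeGap v) ∘′ removeVal v) (sym (upTo-∷ʳ m)) ⟩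
  map (closeGap v) (removeVal v (upTo m ++ [ m ]))
    ≡⟨ cong (map (closeGap v)) (removeVal-++ v (upTo m) [ m ]) ⟩
  map (closeGap v) (removeVal v (upTo m) ++ removeVal v [ m ])
    ≡⟨ map-++ (closeGap v) (removeVal v (upTo m)) _ ⟩
  map (closeGap v) (removeVal v (upTo m)) ++ map (closeGap v) (removeVal v [ m ])
    ≡⟨ last (m<1+n⇒m<n∨m≡n v<1+m) (closeGap-removeVal-upTo m) ⟩
  upTo m
    ∎
  where
  open ≡-Reasoning
  below : map (closeGap m) (upTo m) ≡ upTo m
  below = map-id-local (tabulate λ x∈ → closeGap-≤ (<⇒≤ (∈-upTo⁻ x∈)))
  last : v < m ⊎ v ≡ m → (v < m → map (closeGap v) (removeVal v (upTo m)) ≡ upTo (pred m)) →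
         map (closeGap v) (removeVal v (upTo m)) ++ map (closeGap v) (removeVal v [ m ]) ≡ upTo m
  last (inj₂ refl) _ rewrite removeVal-∷-≡ v [] | removeVal-∉ v (upTo v) (n≮n v ∘′ ∈-upTo⁻) =
    ≡-trans (++-identityʳ _) below
  last (inj₁ v<m@(s≤s _)) ih rewrite removeVal-∷-≢ {v} [] (>⇒≢ v<m) | closeGap-> v<m =
    ≡-trans (cong (_++ [ pred m ]) (ih v<m)) (upTo-∷ʳ (pred m))

module KProperties {n π} (k : K n π) where

  length≡ : length π ≡ n
  length≡ = proj₁ k

  perm : π ↭ upTo n
  perm = subst (λ m → π ↭ upTo m) length≡ (proj₁ (proj₂ k))

  unique : Unique π
  unique = Unique-resp-↭ (↭-sym perm) (upTo⁺ n)

  ∈⇒< : ∀ {x} → x ∈ π → x < n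
  ∈⇒< x∈ = ∈-upTo⁻ (∈-resp-↭ perm x∈)

  <n⇒<∣π∣ : ∀ {i} → i < n → i < length π
  <n⇒<∣π∣ {i} = subst (i <_) (sym length≡)

  at-< : ∀ {i} → i < n → at π i < n
  at-< i<n = ∈⇒< (at-∈ π (<n⇒<∣π∣ i<n))

  injective : ∀ {i j} → i < n → j < n → at π i ≡ at π j → i ≡ j
  injective i<n j<n = at-injective π unique (<n⇒<∣π∣ i<n) (<n⇒<∣π∣ j<n)

  apart : ∀ {i} → suc i < n → ¬ Consecutive (at π i) (at π (suc i))
  apart i+1<n = NoAdj⇒apart π (proj₂ (proj₂ k)) (<n⇒<∣π∣ i+1<n)

-- Deleting a value from an inflation of 3142s and 2413s

Pattern : List ℕ → Set
Pattern p = p ≡ p3142 ⊎ p ≡ p2413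

Pattern-↭ : ∀ {p} → Pattern p → p ↭ upTo 4
Pattern-↭ (inj₁ refl) = trans (swap 2 0 refl) (trans (prep 0 (prep 2 (swap 3 1 refl))) (prep 0 (swap 2 1 refl)))
Pattern-↭ (inj₂ refl) = trans (prep 1 (swap 3 0 refl)) (trans (swap 1 0 refl) (prep 0 (prep 1 (swap 3 2 refl))))

Pattern-length : ∀ {p} → Pattern p → length p ≡ 4
Pattern-length p = ↭-length (Pattern-↭ p)

Pattern-delete : ∀ {p t} → Pattern p → t ∈ p → map (closeGap t) (removeVal t p) ↭ upTo 3
Pattern-delete (inj₁ refl) (here refl)                      = prep 0 (swap 2 1 refl)
Pattern-delete (inj₁ refl) (there (here refl))              = trans (prep 1 (swap 2 0 refl)) (swap 1 0 refl)
Pattern-delete (inj₁ refl) (there (there (here refl)))      = trans (swap 2 0 refl) (prep 0 (swap 2 1 refl))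
Pattern-delete (inj₁ refl) (there (there (there (here refl)))) = swap 1 0 refl
Pattern-delete (inj₂ refl) (here refl)                      = trans (swap 2 0 refl) (prep 0 (swap 2 1 refl))
Pattern-delete (inj₂ refl) (there (here refl))              = swap 1 0 refl
Pattern-delete (inj₂ refl) (there (there (here refl)))      = prep 0 (swap 2 1 refl)
Pattern-delete (inj₂ refl) (there (there (there (here refl)))) = trans (prep 1 (swap 2 0 refl)) (swap 1 0 refl)

∈-concat-shifted : ∀ (h : ℕ → ℕ) vs αs {x} → x ∈ concat (zipWith (λ v α → map (h v +_) α) vs αs) →
  ∃[ A ] ∃[ o ] ∃[ α ] ∃[ C ]
    concat (zipWith (λ v α → map (h v +_) α) vs αs) ≡ A ++ map (o +_) α ++ C × α ∈ αs × x ∈ map (o +_) α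
∈-concat-shifted h (v ∷ vs) (α ∷ αs) x∈ with ∈-++⁻ (map (h v +_) α) x∈
... | inj₁ x∈α = [] , h v , α , _ , refl , here refl , x∈α
... | inj₂ x∈rest with ∈-concat-shifted h vs αs x∈rest
... | A , o , β , C , e , β∈ , x∈β =
  map (h v +_) α ++ A , o , β , C , ≡-trans (cong (map (h v +_) α ++_) e) (sym (++-assoc (map (h v +_) α) A _)) ,
  there β∈ , x∈β

Unique-middle-++ : ∀ (A B C : List ℕ) {x} → Unique (A ++ B ++ C) → x ∈ B → x ∉ A × x ∉ C
Unique-middle-++ A B C {x} u x∈B with ∈-∃++ x∈B
... | B₁ , B₂ , refl with Unique-middle (A ++ B₁) x (B₂ ++ C) (subst Unique reassoc u)
  where
  reassoc : A ++ (B₁ ++ x ∷ B₂) ++ C ≡ (A ++ B₁) ++ x ∷ (B₂ ++ C)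
  reassoc = ≡-trans (cong (A ++_) (++-assoc B₁ (x ∷ B₂) C)) (sym (++-assoc A B₁ _))
... | x∉AB₁ , x∉B₂C = x∉AB₁ ∘′ ∈-++⁺ˡ , x∉B₂C ∘′ ∈-++⁺ʳ B₂

removeVal-middle-++ : ∀ A B C {x} → Unique (A ++ B ++ C) → x ∈ B → removeVal x (A ++ B ++ C) ≡ A ++ removeVal x B ++ C
removeVal-middle-++ A B C {x} u x∈B with Unique-middle-++ A B C u x∈B
... | x∉A , x∉C = begin
  removeVal x (A ++ B ++ C)                          ≡⟨ removeVal-++ x A (B ++ C) ⟩
  removeVal x A ++ removeVal x (B ++ C)              ≡⟨ cong (removeVal x A ++_) (removeVal-++ x B C) ⟩
  removeVal x A ++ removeVal x B ++ removeVal x C    ≡⟨ cong₂ (λ A′ C′ → A′ ++ removeVal x B ++ C′)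
                                                              (removeVal-∉ x A x∉A) (removeVal-∉ x C x∉C) ⟩
  A ++ removeVal x B ++ C                            ∎
  where open ≡-Reasoning

closeGap-removeVal-+ : ∀ o t α →
  map (closeGap (o + t)) (removeVal (o + t) (map (o +_) α)) ≡ map (o +_) (map (closeGap t) (removeVal t α))
closeGap-removeVal-+ o t α = begin
  map (closeGap (o + t)) (removeVal (o + t) (map (o +_) α)) ≡⟨ cong (map (closeGap (o + t))) (removeVal-+ o t α) ⟩
  map (closeGap (o + t)) (map (o +_) (removeVal t α))       ≡⟨ sym (map-∘ (removeVal t α)) ⟩
  map (closeGap (o + t) ∘′ (o +_)) (removeVal t α)          ≡⟨ map-cong (closeGap-+ o t) (removeVal t α) ⟩
  map ((o +_) ∘′ closeGap t) (removeVal t α)                ≡⟨ map-∘ (removeVal t α) ⟩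
  map (o +_) (map (closeGap t) (removeVal t α))             ∎
  where open ≡-Reasoning

cond1⇒cond2 : ∀ {n π} → K n π → Cond1 π → Cond2 n π
cond1⇒cond2 {n} {π} k (_ , αs , π′ , _ , patterns , _ , _ , π≡) i i<n
  with ∈-concat-shifted (offset π′ αs) π′ αs (subst (i ∈_) π≡ (∈-resp-↭ (↭-sym perm) (∈-upTo⁺ i<n)))
  where open KProperties k
... | A , o , α , C , inflation≡ , α∈ , i∈ with ∈-map⁻ (o +_) i∈
... | t , t∈α , refl =
  map (closeGap i) A , map (o +_) β , map (closeGap i) C , o , std≡ ,
  ≡-trans (length-map (o +_) β) (≡-trans (↭-length β↭) (length-upTo 3)) , map⁺ (o +_) β↭
  where
  open KProperties k
  β : List ℕ
  β = map (closeGap t) (removeVal t α)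
  β↭ : β ↭ upTo 3
  β↭ = Pattern-delete (lookup patterns α∈) t∈α
  π≡ABC : π ≡ A ++ map (o +_) α ++ C
  π≡ABC = ≡-trans π≡ inflation≡
  std≡ : std (removeVal i π) ≡ map (closeGap i) A ++ map (o +_) β ++ map (closeGap i) C
  std≡ = begin
    std (removeVal i π)
      ≡⟨ std-removeVal n i perm ⟩
    map (closeGap i) (removeVal i π)
      ≡⟨ cong (map (closeGap i) ∘′ removeVal i) π≡ABC ⟩
    map (closeGap i) (removeVal i (A ++ map (o +_) α ++ C))
      ≡⟨ cong (map (closeGap i)) (removeVal-middle-++ A _ C (subst Unique π≡ABC unique) i∈) ⟩
    map (closeGap i) (A ++ removeVal i (map (o +_) α) ++ C)
      ≡⟨ map-++ (closeGap i) A _ ⟩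
    map (closeGap i) A ++ map (closeGap i) (removeVal i (map (o +_) α) ++ C)
      ≡⟨ cong (map (closeGap i) A ++_) (map-++ (closeGap i) (removeVal i (map (o +_) α)) C) ⟩
    map (closeGap i) A ++ map (closeGap i) (removeVal i (map (o +_) α)) ++ map (closeGap i) C
      ≡⟨ cong (λ B′ → map (closeGap i) A ++ B′ ++ map (closeGap i) C) (closeGap-removeVal-+ o t α) ⟩
    map (closeGap i) A ++ map (o +_) β ++ map (closeGap i) C
      ∎
    where open ≡-Reasoning

-- Princes are deletions

⊆-length-≡⇒≡ : ∀ {xs ys : List ℕ} → xs ⊆ ys → length xs ≡ length ys → xs ≡ ys
⊆-length-≡⇒≡ []         _   = refl
⊆-length-≡⇒≡ (y ∷ʳ xs⊆) ∣≡∣ = contradiction (subst (_≤ _) ∣≡∣ (length-mono-≤ xs⊆)) (n≮n _)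
⊆-length-≡⇒≡ (refl ∷ xs⊆) ∣≡∣ = cong (_ ∷_) (⊆-length-≡⇒≡ xs⊆ (suc-injective ∣≡∣))

⊆-drop-one : ∀ {xs ys : List ℕ} → xs ⊆ ys → suc (length xs) ≡ length ys →
  ∃[ L ] ∃[ v ] ∃[ R ] ys ≡ L ++ v ∷ R × xs ≡ L ++ R
⊆-drop-one (y ∷ʳ xs⊆) ∣≡∣ = [] , y , _ , refl , ⊆-length-≡⇒≡ xs⊆ (suc-injective ∣≡∣)
⊆-drop-one (_∷_ {x = x} refl xs⊆) ∣≡∣ with ⊆-drop-one xs⊆ (suc-injective ∣≡∣)
... | L , v , R , ys≡ , xs≡ = x ∷ L , v , R , cong (x ∷_) ys≡ , cong (x ∷_) xs≡

consecutive-to-middle : ∀ {m w} → w ∈ map (m +_) (upTo 3) → w ≢ m + 1 → Consecutive w (m + 1)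
consecutive-to-middle {m} (here refl)                 _   = inj₁ (sym (+-suc m 0))
consecutive-to-middle     (there (here refl))         w≢  = contradiction refl w≢
consecutive-to-middle {m} (there (there (here refl))) _   = inj₂ (sym (+-suc m 1))

-- Wherever the middle value m + 1 of the block sits, one of its neighbours in
-- the block is consecutive to it.
HasBlock3⇒¬NoAdj : ∀ τ → HasBlock 3 τ → ¬ NoAdj τ
HasBlock3⇒¬NoAdj τ (a , x ∷ y ∷ z ∷ [] , c , m , refl , _ , b↭) noAdj
  with NoAdj-++⁻ʳ a noAdj | Unique-resp-↭ (↭-sym b↭) (UniqueP.map⁺ (+-cancelˡ-≡ m _ _) (upTo⁺ 3))
     | ∈-resp-↭ (↭-sym b↭) (there (here refl))
... | x≁y , _   , _ | (x≢y ∷ _) ∷ _            | here refl =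
  x≁y (Consecutive-sym (consecutive-to-middle (∈-resp-↭ b↭ (there (here refl))) (x≢y ∘′ sym)))
... | x≁y , _   , _ | (x≢y ∷ _) ∷ _            | there (here refl) =
  x≁y (consecutive-to-middle (∈-resp-↭ b↭ (here refl)) x≢y)
... | _   , y≁z , _ | _ ∷ (y≢z ∷ []) ∷ _       | there (there (here refl)) =
  y≁z (consecutive-to-middle (∈-resp-↭ b↭ (there (here refl))) y≢z)

cond2⇒cond3 : ∀ {n π} → 1 ≤ n → K n π → Cond2 n π → Cond3 n π
cond2⇒cond3 {n} {π} 1≤n k c2 (τ , (∣τ∣ , τ↭ , τ-noAdj) , (σ , σ⊆π , stdσ≡stdτ) , _)
  with ⊆-drop-one σ⊆π ∣σ∣+1≡∣π∣
  where
  open KProperties k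
  ∣σ∣+1≡∣π∣ : suc (length σ) ≡ length π
  ∣σ∣+1≡∣π∣ = begin
    suc (length σ)           ≡⟨ cong suc (sym (length-map _ σ)) ⟩
    suc (length (std σ))     ≡⟨ cong (suc ∘′ length) stdσ≡stdτ ⟩
    suc (length (std τ))     ≡⟨ cong suc (length-map _ τ) ⟩
    suc (length τ)           ≡⟨ cong suc ∣τ∣ ⟩
    suc (n ∸ 1)              ≡⟨ m+[n∸m]≡n 1≤n ⟩
    n                        ≡⟨ sym length≡ ⟩
    length π                 ∎
    where open ≡-Reasoning
... | L , v , R , π≡ , σ≡ = HasBlock3⇒¬NoAdj τ (subst (HasBlock 3) removed≡τ (c2 v (∈⇒< v∈π))) τ-noAdj
  where
  open KProperties k
  v∈π : v ∈ π
  v∈π = subst (v ∈_) (sym π≡) (∈-++⁺ʳ L (here refl))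
  removed≡τ : std (removeVal v π) ≡ τ
  removed≡τ = begin
    std (removeVal v π)         ≡⟨ cong (std ∘′ removeVal v) π≡ ⟩
    std (removeVal v (L ++ v ∷ R)) ≡⟨ cong std (removeVal-middle L v R (subst Unique π≡ unique)) ⟩
    std (L ++ R)                ≡⟨ cong std (sym σ≡) ⟩
    std σ                       ≡⟨ stdσ≡stdτ ⟩
    std τ                       ≡⟨ std-↭-upTo (length τ) τ↭ ⟩
    τ                           ∎
    where open ≡-Reasoning

-- Without princes every deletion creates an adjacency

PosBridge : ℕ → (ℕ → ℕ) → ℕ → Set
PosBridge n f q = ∃[ p ] suc p ≡ q × suc q < n × Consecutive (f p) (f (suc q))

ValBridge : ℕ → (ℕ → ℕ) → ℕ → Set
ValBridge n f q = ∃[ r ] suc r < n × Between (f r) (f (suc r)) (f q)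

-- Position q is bridged when deleting it creates an adjacency: its two neighbours are
-- consecutive, or the values f q - 1 and f q + 1 are adjacent.
Bridged : ℕ → (ℕ → ℕ) → ℕ → Set
Bridged n f q = PosBridge n f q ⊎ ValBridge n f q

Bridged? : ∀ n f q → Dec (Bridged n f q)
Bridged? n f q = posBridge? q ⊎-dec valBridge?
  where
  posBridge? : ∀ q → Dec (PosBridge n f q)
  posBridge? zero    = no λ { (_ , () , _) }
  posBridge? (suc p) with suc (suc p) <? n | Consecutive? (f p) (f (suc (suc p)))
  ... | yes q+1<n | yes c = yes (p , refl , q+1<n , c)
  ... | no  q+1≮n | _     = no λ { (_ , refl , q+1<n , _) → q+1≮n q+1<n }
  ... | _         | no ¬c = no λ { (_ , refl , _ , c) → ¬c c }
  valBridge? : Dec (ValBridge n f q)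
  valBridge? with anyUpTo? (λ r → (suc r <? n) ×-dec Between? (f r) (f (suc r)) (f q)) n
  ... | yes (r , _ , r+1<n , b) = yes (r , r+1<n , b)
  ... | no  ∄r                  = no λ { (r , r+1<n , b) → ∄r (r , <⇒≤ r+1<n , r+1<n , b) }

module Deletion {n π} (k : K n π) {q} (q<n : q < n) (unbridged : ¬ Bridged n (at π) q) where
  open KProperties k

  v : ℕ
  v = at π q

  split : ∃[ L ] ∃[ R ] π ≡ L ++ v ∷ R × length L ≡ q
  split = at-split π (<n⇒<∣π∣ q<n)

  L R : List ℕ
  L = proj₁ split
  R = proj₁ (proj₂ split)

  π≡ : π ≡ L ++ v ∷ R
  π≡ = proj₁ (proj₂ (proj₂ split))

  ∣L∣≡q : length L ≡ q
  ∣L∣≡q = proj₂ (proj₂ (proj₂ split))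

  σ : List ℕ
  σ = removeVal v π

  σ≡ : σ ≡ L ++ R
  σ≡ = ≡-trans (cong (removeVal v) π≡) (removeVal-middle L v R (subst Unique π≡ unique))

  τ : List ℕ
  τ = map (closeGap v) σ

  τ↭ : τ ↭ upTo (n ∸ 1)
  τ↭ = subst (τ ↭_) (closeGap-removeVal-upTo n (at-< q<n)) (map⁺ (closeGap v) (filter-↭ (λ x → ¬? (x ≟ v)) perm))

  ∣τ∣ : length τ ≡ n ∸ 1
  ∣τ∣ = ≡-trans (↭-length τ↭) (length-upTo (n ∸ 1))

  at-τ : ∀ {i} → i < n ∸ 1 → at τ i ≡ closeGap v (at (L ++ R) i)
  at-τ {i} i< = ≡-trans (at-map (closeGap v) σ (subst (i <_) (≡-trans (sym ∣τ∣) (length-map _ σ)) i<))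
                        (cong (λ xs → closeGap v (at xs i)) σ≡)

  at-τ-below : ∀ {i} → i < q → i < n ∸ 1 → at τ i ≡ closeGap v (at π i)
  at-τ-below i<q i< = ≡-trans (at-τ i<) (cong (closeGap v)
    (≡-trans (at-++-∷-below L v R (subst (_ <_) (sym ∣L∣≡q) i<q)) (cong (λ xs → at xs _) (sym π≡))))

  at-τ-above : ∀ {i} → q ≤ i → i < n ∸ 1 → at τ i ≡ closeGap v (at π (suc i))
  at-τ-above q≤i i< = ≡-trans (at-τ i<) (cong (closeGap v)
    (≡-trans (at-++-∷-above L v R (subst (_≤ _) (sym ∣L∣≡q) q≤i)) (cong (λ xs → at xs _) (sym π≡))))

  1+[n∸1]≡n : suc (n ∸ 1) ≡ n
  1+[n∸1]≡n = m+[n∸m]≡n (≤-<-trans z≤n q<n)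

  ≢v : ∀ {j} → j < n → j ≢ q → at π j ≢ v
  ≢v j<n j≢q = j≢q ∘′ injective j<n q<n

  adjacent-pair : ∀ {r} → suc r < n → r ≢ q → suc r ≢ q →
    ¬ Consecutive (closeGap v (at π r)) (closeGap v (at π (suc r)))
  adjacent-pair {r} r+1<n r≢q r+1≢q c
    with closeGap-consecutive (≢v (<⇒≤ r+1<n) r≢q) (≢v r+1<n r+1≢q) c
  ... | inj₁ c′ = apart r+1<n c′
  ... | inj₂ b  = unbridged (inj₂ (r , r+1<n , b))

  straddling-pair : ∀ {p} → suc p ≡ q → suc q < n →
    ¬ Consecutive (closeGap v (at π p)) (closeGap v (at π (suc q)))
  straddling-pair {p} refl q+1<n c
    with closeGap-consecutive (≢v (<⇒≤ q<n) (1+n≢n ∘′ sym)) (≢v q+1<n 1+n≢n) c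
  ... | inj₁ c′ = unbridged (inj₁ (p , refl , q+1<n , c′))
  ... | inj₂ b  = apart q<n (Between⇒Consecutive b)

  noAdj : NoAdj τ
  noAdj = apart⇒NoAdj τ λ {i} i+1<∣τ∣ → pair (subst (suc i <_) ∣τ∣ i+1<∣τ∣)
    where
    i+2<n : ∀ {i} → suc i < n ∸ 1 → suc (suc i) < n
    i+2<n i+1< = subst (_ <_) 1+[n∸1]≡n (s≤s i+1<)
    pair : ∀ {i} → suc i < n ∸ 1 → ¬ Consecutive (at τ i) (at τ (suc i))
    pair {i} i+1< c with <-cmp (suc i) q
    ... | tri< i+1<q _ _ = adjacent-pair (<⇒≤ (i+2<n i+1<)) (<⇒≢ (<⇒≤ i+1<q)) (<⇒≢ i+1<q)
      (subst₂ Consecutive (at-τ-below (<⇒≤ i+1<q) (<⇒≤ i+1<)) (at-τ-below i+1<q i+1<) c)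
    ... | tri≈ _ i+1≡q _ = straddling-pair i+1≡q (subst (λ j → suc j < n) i+1≡q (i+2<n i+1<))
      (subst₂ Consecutive (at-τ-below (subst (i <_) i+1≡q (n<1+n i)) (<⇒≤ i+1<))
                          (≡-trans (at-τ-above (≤-reflexive (sym i+1≡q)) i+1<)
                                   (cong (λ j → closeGap v (at π (suc j))) i+1≡q)) c)
    ... | tri> _ _ q<i+1 = adjacent-pair (i+2<n i+1<) (>⇒≢ q<i+1) (>⇒≢ (<-trans q<i+1 (n<1+n _)))
      (subst₂ Consecutive (at-τ-above (≤-pred q<i+1) (<⇒≤ i+1<)) (at-τ-above (<⇒≤ q<i+1) i+1<) c)

  prince : ∃[ τ′ ] Prince n τ′ π
  prince = τ , (∣τ∣ , subst (λ m → τ ↭ upTo m) (sym ∣τ∣) τ↭ , noAdj) ,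
           (σ , filter-⊆ (λ x → ¬? (x ≟ v)) π , ≡-trans (std-removeVal n v perm) (sym (std-↭-upTo (n ∸ 1) τ↭))) ,
           λ τ≡π → n≮n n (subst (_< n) (≡-trans (sym ∣τ∣) (≡-trans (cong length τ≡π) length≡))
                                       (≤-reflexive 1+[n∸1]≡n))

cond3⇒bridged : ∀ {n π} → K n π → Cond3 n π → ∀ {q} → q < n → Bridged n (at π) q
cond3⇒bridged {n} {π} k noPrince {q} q<n with Bridged? n (at π) q
... | yes b  = b
... | no ¬b  = contradiction (Deletion.prince k q<n ¬b) noPrince

-- Abstracting π to a function on positions lets the descending case reuse the
-- ascending one for the complemented values.
record Layout (n : ℕ) (f : ℕ → ℕ) : Set where
  field
    injective : ∀ {i j} → i < n → j < n → f i ≡ f j → i ≡ j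
    apart     : ∀ {i} → suc i < n → ¬ Consecutive (f i) (f (suc i))
    bridged   : ∀ {q} → q < n → Bridged n f q

cond3⇒Layout : ∀ {n π} → K n π → Cond3 n π → Layout n (at π)
cond3⇒Layout k noPrince = record
  { injective = injective ; apart = apart ; bridged = cond3⇒bridged k noPrince }
  where open KProperties k

-- Invariants of the left-to-right scan, at the position s where the next block starts.
LastUnlinked : ℕ → (ℕ → ℕ) → ℕ → Set
LastUnlinked n f s = ∀ {x y} → suc x ≡ s → s ≤ y → y < n → ¬ Consecutive (f x) (f y)

BetweenClosed : ℕ → (ℕ → ℕ) → ℕ → Set
BetweenClosed n f s = ∀ {x z} → suc x < s → z < n → Between (f x) (f (suc x)) (f z) → z < s

Block : (ℕ → ℕ) → ℕ → ℕ → List ℕ → Set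
Block f s o p = ∀ {j} → j < 4 → f (j + s) ≡ at p j + o

-- If f s = o + 1 is bridged by an ascending pair (f r , f (r + 1)) = (o , o + 2),
-- then chasing the bridges of r, r + 1 and r - 1 forces r = s + 2 and
-- f (s + 1) = o + 3: positions s, …, s + 3 carry 2413.
module Ascending {n f} (layout : Layout n f) {s r} (s<n : s < n)
                 (unlinked : LastUnlinked n f s) (closed : BetweenClosed n f s) (r+1<n : suc r < n)
                 (below : suc (f r) ≡ f s) (above : suc (f s) ≡ f (suc r)) where
  open Layout layout

  o : ℕ
  o = f r

  r<n : r < n
  r<n = <⇒≤ r+1<n

  f[1+r]≡ : f (suc r) ≡ 2 + o
  f[1+r]≡ = ≡-trans (sym above) (cong suc (sym below))

  s+2≤r : 2 + s ≤ r
  s+2≤r with <-cmp r s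
  ... | tri< r<s _ _ with m≤n⇒m<n∨m≡n r<s
  ...   | inj₁ r+1<s = contradiction (closed r+1<s s<n (inj₁ (below , above))) (n≮n s)
  ...   | inj₂ refl  = contradiction above 1+n≢n
  s+2≤r | tri≈ _ refl _ = contradiction below 1+n≢n
  s+2≤r | tri> _ _ s<r with m≤n⇒m<n∨m≡n s<r
  ...   | inj₁ s+1<r = s+1<r
  ...   | inj₂ refl  = contradiction (inj₂ below) (apart r<n)

  s<r : s < r
  s<r = <⇒≤ s+2≤r

  1+s<n : suc s < n
  1+s<n = <-trans s+2≤r r<n

  left : (∃[ p ] suc p ≡ r × f p ≡ 3 + o) ⊎ suc (f (suc s)) ≡ o
  left with bridged r<n
  ... | inj₁ (p , refl , _ , inj₁ e) =
    contradiction (cong suc (injective (<⇒≤ r<n) s<n (suc-injective (≡-trans e (sym above)))))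
                  (<⇒≢ s+2≤r ∘′ sym)
  ... | inj₁ (p , p+1≡r , _ , inj₂ e) = inj₁ (p , p+1≡r , ≡-trans (sym e) (cong suc f[1+r]≡))
  ... | inj₂ (r′ , r′+1<n , inj₁ (e₁ , e₂)) =
    contradiction (inj₁ e₁) (unlinked (injective r′+1<n s<n (≡-trans (sym e₂) below)) (<⇒≤ s<r) r<n)
  ... | inj₂ (r′ , r′+1<n , inj₂ (e₁ , e₂)) with injective (<⇒≤ r′+1<n) s<n (≡-trans (sym e₂) below)
  ...   | refl = inj₂ e₁

  right : (suc (f (2 + r)) ≡ o × 2 + r < n) ⊎ f (suc s) ≡ 3 + o
  right with bridged r+1<n
  ... | inj₁ (.r , refl , 2+r<n , inj₁ e) =
    contradiction (injective s<n 2+r<n (≡-trans (sym below) e)) (<⇒≢ (<-≤-trans s<r (m≤n+m r 2)))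
  ... | inj₁ (.r , refl , 2+r<n , inj₂ e) = inj₁ (e , 2+r<n)
  ... | inj₂ (r′ , r′+1<n , inj₁ (e₁ , e₂))
    with injective (<⇒≤ r′+1<n) s<n (suc-injective (≡-trans e₁ (sym above)))
  ...   | refl = inj₂ (≡-trans (sym e₂) (cong suc f[1+r]≡))
  right | inj₂ (r′ , r′+1<n , inj₂ (e₁ , e₂)) =
    contradiction (inj₂ e₂)
      (unlinked (injective r′+1<n s<n (suc-injective (≡-trans e₁ (sym above)))) (≤-trans (<⇒≤ s<r) (n≤1+n r)) r+1<n)

  outer : ∀ {p} → suc p ≡ r → f p ≡ 3 + o → suc (f (2 + r)) ≡ o → 2 + r < n → r ≡ 2 + s
  outer {p} refl fp≡ f[2+r]≡ 2+r<n with bridged (<⇒≤ r<n)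
  ... | inj₁ (p′ , refl , _ , inj₁ e) =
    contradiction (injective (<⇒≤ (<⇒≤ r<n)) 2+r<n (suc-injective (≡-trans e (sym f[2+r]≡))))
                  (<⇒≢ (m<n+m p′ (s≤s z≤n)))
  ... | inj₁ (p′ , refl , _ , inj₂ e) = cong (2 +_) (injective (<⇒≤ (<⇒≤ r<n)) s<n (≡-trans (sym e) below))
  ... | inj₂ (r′ , r′+1<n , inj₁ (e₁ , e₂))
    with injective (<⇒≤ r′+1<n) r+1<n (suc-injective (≡-trans e₁ (≡-trans fp≡ (sym (cong suc f[1+r]≡)))))
  ...   | refl = contradiction (≡-trans (sym f[2+r]≡) (≡-trans (cong suc (sym e₂)) (cong (2 +_) fp≡))) (m≢1+n+m o)
  outer {p} refl fp≡ f[2+r]≡ 2+r<n | inj₂ (r′ , r′+1<n , inj₂ (e₁ , e₂))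
    with injective r′+1<n r+1<n (suc-injective (≡-trans e₁ (≡-trans fp≡ (sym (cong suc f[1+r]≡)))))
  ... | refl = contradiction (≡-trans (sym e₂) (cong suc fp≡)) (m≢1+n+m o)

  shape : r ≡ 2 + s × f (suc s) ≡ 3 + o
  shape with left | right
  ... | inj₁ (p , refl , fp≡) | inj₂ f[1+s]≡ =
    cong suc (injective (<⇒≤ r<n) 1+s<n (≡-trans fp≡ (sym f[1+s]≡))) , f[1+s]≡
  ... | inj₁ (p , p+1≡r , fp≡) | inj₁ (f[2+r]≡ , 2+r<n) with outer p+1≡r fp≡ f[2+r]≡ 2+r<n
  ...   | r≡2+s with suc-injective (≡-trans p+1≡r r≡2+s)
  ...     | refl = r≡2+s , fp≡
  shape | inj₂ e | inj₂ f[1+s]≡ = contradiction (≡-trans (sym e) (cong suc f[1+s]≡)) (m≢1+n+m o)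
  shape | inj₂ e | inj₁ (f[2+r]≡ , 2+r<n) =
    contradiction (injective 1+s<n 2+r<n (suc-injective (≡-trans e (sym f[2+r]≡)))) (<⇒≢ (<-trans (s≤s s<r) (n<1+n _)))

  block : 3 + s < n × Block f s o p2413
  block with shape
  ... | refl , f[1+s]≡ = r+1<n , values
    where
    values : Block f s o p2413
    values {0} _ = sym below
    values {1} _ = f[1+s]≡
    values {2} _ = refl
    values {3} _ = f[1+r]≡
    values {suc (suc (suc (suc _)))} (s≤s (s≤s (s≤s (s≤s ()))))

record Complement (n : ℕ) (f g : ℕ → ℕ) : Set where
  constructor complement
  field
    sum-constant : ∀ {i j} → i < n → j < n → f i + g i ≡ f j + g j

complement-sym : ∀ {n f g} → Complement n f g → Complement n g f
complement-sym {f = f} {g} (complement c) = complement λ {i} {j} i<n j<n →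
  ≡-trans (+-comm (g i) (f i)) (≡-trans (c i<n j<n) (+-comm (f j) (g j)))

complement-∸ : ∀ {n f c} → (∀ {i} → i < n → f i ≤ c) → Complement n f (λ i → c ∸ f i)
complement-∸ ≤c = complement λ i<n j<n → ≡-trans (m+[n∸m]≡n (≤c i<n)) (sym (m+[n∸m]≡n (≤c j<n)))

complement-shift : ∀ {n f g} → Complement n f g → ∀ {i j} k → i < n → j < n → g i ≡ k + g j → f j ≡ k + f i
complement-shift {f = f} {g} c {i} {j} k i<n j<n gi≡ = sym (≡-trans (+-comm k (f i)) (+-cancelʳ-≡ (g j) (f i + k) (f j) (begin
  f i + k + g j     ≡⟨ +-assoc (f i) k (g j) ⟩
  f i + (k + g j)   ≡⟨ cong (f i +_) (sym gi≡) ⟩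
  f i + g i         ≡⟨ Complement.sum-constant c i<n j<n ⟩
  f j + g j         ∎)))
  where open ≡-Reasoning

suc-complement : ∀ {n f g} → Complement n f g → ∀ {a b} → a < n → b < n → suc (f a) ≡ f b → suc (g b) ≡ g a
suc-complement c a<n b<n e = sym (complement-shift (complement-sym c) 1 b<n a<n (sym e))

consecutive-complement : ∀ {n f g} → Complement n f g → ∀ {a b} → a < n → b < n →
  Consecutive (f a) (f b) → Consecutive (g a) (g b)
consecutive-complement c a<n b<n (inj₁ e) = inj₂ (suc-complement c a<n b<n e)
consecutive-complement c a<n b<n (inj₂ e) = inj₁ (suc-complement c b<n a<n e)

between-complement : ∀ {n f g} → Complement n f g → ∀ {a b z} → a < n → b < n → z < n →
  Between (f a) (f b) (f z) → Between (g a) (g b) (g z)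
between-complement c a<n b<n z<n (inj₁ (e₁ , e₂)) = inj₂ (suc-complement c z<n b<n e₂ , suc-complement c a<n z<n e₁)
between-complement c a<n b<n z<n (inj₂ (e₁ , e₂)) = inj₁ (suc-complement c z<n a<n e₂ , suc-complement c b<n z<n e₁)

Layout-complement : ∀ {n f g} → Layout n f → Complement n f g → Layout n g
Layout-complement {n} {f} {g} layout c = record
  { injective = λ i<n j<n gi≡gj → sym (injective j<n i<n (complement-shift c 0 i<n j<n gi≡gj))
  ; apart     = λ i+1<n cons → apart i+1<n (consecutive-complement (complement-sym c) (<⇒≤ i+1<n) i+1<n cons)
  ; bridged   = bridged′
  }
  where
  open Layout layout
  bridged′ : ∀ {q} → q < n → Bridged n g q
  bridged′ q<n with bridged q<n
  ... | inj₁ (p , refl , q+1<n , cons) = inj₁ (p , refl , q+1<n , consecutive-complement c (<⇒≤ q<n) q+1<n cons)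
  ... | inj₂ (r , r+1<n , b) = inj₂ (r , r+1<n , between-complement c (<⇒≤ r+1<n) r+1<n q<n b)

LastUnlinked-complement : ∀ {n f g s} → Complement n f g → LastUnlinked n f s → LastUnlinked n g s
LastUnlinked-complement c unlinked {x} refl s≤y y<n cons =
  unlinked refl s≤y y<n (consecutive-complement (complement-sym c) (<⇒≤ (≤-<-trans s≤y y<n)) y<n cons)

BetweenClosed-complement : ∀ {n f g s} → Complement n f g → s ≤ n → BetweenClosed n f s → BetweenClosed n g s
BetweenClosed-complement {n} c s≤n closed {x} x+1<s z<n b =
  closed x+1<s z<n (between-complement (complement-sym c) (<⇒≤ x+1<n) x+1<n z<n b)
  where
  x+1<n : suc x < n
  x+1<n = <-≤-trans x+1<s s≤n

Block-complement : ∀ {n f g s o} → Complement n f g → 3 + s < n → Block g s o p2413 → Block f s (f (suc s)) p3142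
Block-complement {n} {f} {g} {s} {o} c 3+s<n block = values
  where
  2+s<n : 2 + s < n
  2+s<n = <⇒≤ 3+s<n
  1+s<n : 1 + s < n
  1+s<n = <⇒≤ 2+s<n
  0+s<n : s < n
  0+s<n = <⇒≤ 1+s<n
  g₀ : g s ≡ 1 + o
  g₀ = block (s≤s z≤n)
  g₁ : g (1 + s) ≡ 3 + o
  g₁ = block (s≤s (s≤s z≤n))
  g₂ : g (2 + s) ≡ o
  g₂ = block (s≤s (s≤s (s≤s z≤n)))
  g₃ : g (3 + s) ≡ 2 + o
  g₃ = block (s≤s (s≤s (s≤s (s≤s z≤n))))
  values : Block f s (f (suc s)) p3142
  values {0} _ = complement-shift c 2 1+s<n 0+s<n (≡-trans g₁ (cong (2 +_) (sym g₀)))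
  values {1} _ = refl
  values {2} _ = complement-shift c 3 1+s<n 2+s<n (≡-trans g₁ (cong (3 +_) (sym g₂)))
  values {3} _ = complement-shift c 1 1+s<n 3+s<n (≡-trans g₁ (cong (1 +_) (sym g₃)))
  values {suc (suc (suc (suc _)))} (s≤s (s≤s (s≤s (s≤s ()))))

-- Cutting π into blocks from the left

Tile : ℕ → (ℕ → ℕ) → ℕ → Set
Tile n f s = 3 + s < n × ∃[ o ] ∃[ p ] Pattern p × Block f s o p

Pattern-last : ∀ {p} → Pattern p → 1 ≤ at p 3 × at p 3 ≤ 2
Pattern-last (inj₁ refl) = s≤s z≤n , s≤s z≤n
Pattern-last (inj₂ refl) = s≤s z≤n , s≤s (s≤s z≤n)

consecutive-bounded : ∀ {e o w} → 1 ≤ e → e ≤ 2 → Consecutive (e + o) w → o ≤ w × w ≤ 3 + o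
consecutive-bounded {e} {o} 1≤e e≤2 (inj₁ refl) = ≤-trans (m≤n+m o e) (n≤1+n _) , s≤s (+-monoˡ-≤ o e≤2)
consecutive-bounded {e} {o} 1≤e e≤2 (inj₂ w+1≡) =
  ≤-pred (subst (suc o ≤_) (sym w+1≡) (+-monoˡ-≤ o 1≤e)) ,
  ≤-trans (n≤1+n _) (subst (_≤ 3 + o) (sym w+1≡) (+-monoˡ-≤ o (≤-trans e≤2 (n≤1+n 2))))

between-bounded : ∀ {a b c o h} → Between a b c → o ≤ a → o ≤ b → a ≤ h → b ≤ h → o ≤ c × c ≤ h
between-bounded (inj₁ (refl , refl)) o≤a _ _ b≤h = m≤n⇒m≤1+n o≤a , ≤-trans (n≤1+n _) b≤h
between-bounded (inj₂ (refl , refl)) _ o≤b a≤h _ = m≤n⇒m≤1+n o≤b , ≤-trans (n≤1+n _) a≤h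

module Scan {n f g} (layout : Layout n f) (c : Complement n f g) where
  open Layout layout

  tileAt : ∀ {s} → s < n → LastUnlinked n f s → BetweenClosed n f s → Tile n f s
  tileAt s<n unlinked closed with bridged s<n
  ... | inj₁ (p , p+1≡s , s+1<n , cons) = contradiction cons (unlinked p+1≡s (n≤1+n _) s+1<n)
  ... | inj₂ (r , r+1<n , inj₁ (below , above)) with Ascending.block layout s<n unlinked closed r+1<n below above
  ...   | 3+s<n , block = 3+s<n , f r , p2413 , inj₂ refl , block
  -- A descending bridge is an ascending one for the complement, which turns 2413 into 3142.
  tileAt {s} s<n unlinked closed | inj₂ (r , r+1<n , inj₂ (e₁ , e₂))
    with Ascending.block (Layout-complement layout c) s<n
           (LastUnlinked-complement c unlinked) (BetweenClosed-complement c (<⇒≤ s<n) closed) r+1<n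
           (suc-complement c s<n r<n e₂) (suc-complement c r+1<n s<n e₁)
    where
    r<n : r < n
    r<n = <⇒≤ r+1<n
  ... | 3+s<n , block = 3+s<n , f (suc s) , p3142 , inj₁ refl , Block-complement c 3+s<n block

  module _ {s o p} (pat : Pattern p) (block : Block f s o p) (3+s<n : 3 + s < n) where

    Block-bounded : ∀ {i} → s ≤ i → i ≤ 3 + s → o ≤ f i × f i ≤ 3 + o
    Block-bounded {i} s≤i i≤3+s =
      subst (λ v → o ≤ v × v ≤ 3 + o) (≡-trans (sym (block j<4)) (cong f (m∸n+n≡m s≤i)))
            (m≤n+m o (at p j) , +-monoˡ-≤ o (≤-pred pj<4))
      where
      j : ℕ
      j = i ∸ s
      j<4 : j < 4
      j<4 = s≤s (subst (j ≤_) (m+n∸n≡m 3 s) (∸-monoˡ-≤ s i≤3+s))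
      pj<4 : at p j < 4
      pj<4 = ∈-upTo⁻ (∈-resp-↭ (Pattern-↭ pat) (at-∈ p (subst (j <_) (sym (Pattern-length pat)) j<4)))

    Block-position : ∀ {z} → z < n → o ≤ f z → f z ≤ 3 + o → z < 4 + s
    Block-position {z} z<n o≤fz fz≤ with ∈⇒at (∈-resp-↭ (↭-sym (Pattern-↭ pat)) (∈-upTo⁺ d<4))
      where
      d<4 : f z ∸ o < 4
      d<4 = s≤s (subst (f z ∸ o ≤_) (m+n∸n≡m 3 o) (∸-monoˡ-≤ o fz≤))
    ... | j , j<∣p∣ , pj≡ = subst (_< 4 + s) (sym z≡) (+-monoˡ-< s j<4)
      where
      j<4 : j < 4
      j<4 = subst (j <_) (Pattern-length pat) j<∣p∣
      z≡ : z ≡ j + s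
      z≡ = injective z<n (≤-<-trans (+-monoˡ-≤ s (≤-pred j<4)) 3+s<n)
             (≡-trans (sym (m∸n+n≡m o≤fz)) (≡-trans (cong (_+ o) (sym pj≡)) (sym (block j<4))))

    unlinked-next : LastUnlinked n f (4 + s)
    unlinked-next {y = y} refl 4+s≤y y<n cons with Pattern-last pat
    ... | 1≤e , e≤2 with consecutive-bounded 1≤e e≤2 (subst (λ v → Consecutive v (f y)) (block ≤-refl) cons)
    ...   | o≤fy , fy≤ = n≮n _ (<-≤-trans (Block-position y<n o≤fy fy≤) 4+s≤y)

    closed-next : LastUnlinked n f s → BetweenClosed n f s → BetweenClosed n f (4 + s)
    closed-next unlinked closed {x} {z} x+1<4+s z<n b with suc x <? s
    ... | yes x+1<s = ≤-trans (closed x+1<s z<n b) (m≤n+m s 4)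
    ... | no  x+1≮s with m≤n⇒m<n∨m≡n (≮⇒≥ x+1≮s)
    ...   | inj₂ s≡x+1 with z <? s
    ...     | yes z<s = ≤-trans z<s (m≤n+m s 4)
    ...     | no  z≮s = contradiction (Between⇒Consecutive b) (unlinked (sym s≡x+1) (≮⇒≥ z≮s) z<n)
    closed-next unlinked closed {x} {z} x+1<4+s z<n b | no _ | inj₁ s<x+1
      with Block-bounded (≤-pred s<x+1) (≤-trans (n≤1+n x) (≤-pred x+1<4+s))
         | Block-bounded (<⇒≤ s<x+1) (≤-pred x+1<4+s)
    ... | o≤fx , fx≤ | o≤fx+1 , fx+1≤ with between-bounded b o≤fx o≤fx+1 fx≤ fx+1≤
    ...   | o≤fz , fz≤ = Block-position z<n o≤fz fz≤

drop-shifted : ∀ xs {s o} p → (∀ {j} → j < length p → at xs (j + s) ≡ at p j + o) → length p + s ≤ length xs →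
  drop s xs ≡ map (o +_) p ++ drop (length p + s) xs
drop-shifted xs         []      _      _ = refl
drop-shifted xs {s} {o} (a ∷ p) entries ≤∣xs∣ = begin
  drop s xs
    ≡⟨ drop-at xs (<-≤-trans (m<n+m s (s≤s z≤n)) ≤∣xs∣) ⟩
  at xs s ∷ drop (suc s) xs
    ≡⟨ cong₂ _∷_ (≡-trans (entries (s≤s z≤n)) (+-comm a o)) rest ⟩
  o + a ∷ map (o +_) p ++ drop (length p + suc s) xs
    ≡⟨ cong (λ m → o + a ∷ map (o +_) p ++ drop m xs) (+-suc (length p) s) ⟩
  o + a ∷ map (o +_) p ++ drop (suc (length p + s)) xs
    ∎
  where
  open ≡-Reasoning
  rest : drop (suc s) xs ≡ map (o +_) p ++ drop (length p + suc s) xs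
  rest = drop-shifted xs p (λ {j} j< → ≡-trans (cong (at xs) (+-suc j s)) (entries (s≤s j<)))
                          (subst (_≤ length xs) (sym (+-suc (length p) s)) ≤∣xs∣)

shifted : ℕ × List ℕ → List ℕ
shifted (o , p) = map (o +_) p

module Tiling {n π} (k : K n π) (noPrince : Cond3 n π) where
  open KProperties k using (length≡; at-<)
  open Scan (cond3⇒Layout k noPrince) (complement-∸ (<⇒≤ ∘′ at-<))

  tiling : ∀ fuel {s} → s ≤ n → n ≤ fuel + s → LastUnlinked n (at π) s → BetweenClosed n (at π) s →
    ∃[ bs ] drop s π ≡ concat (map shifted bs) × All (Pattern ∘′ proj₂) bs
  tiling fuel {s} s≤n n≤ unlinked closed with s <? n
  ... | no s≮n = [] , drop-all s π (subst (_≤ s) (sym length≡) (≮⇒≥ s≮n)) , []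
  tiling zero       s≤n n≤ unlinked closed | yes s<n = contradiction (<-≤-trans s<n n≤) (n≮n _)
  tiling (suc fuel) {s} s≤n n≤ unlinked closed | yes s<n with tileAt s<n unlinked closed
  ... | 3+s<n , o , p , pat , block
    with tiling fuel 3+s<n n≤fuel+4+s (unlinked-next pat block 3+s<n) (closed-next pat block 3+s<n unlinked closed)
    where
    n≤fuel+4+s : n ≤ fuel + (4 + s)
    n≤fuel+4+s = ≤-trans n≤ (≤-trans (≤-reflexive (sym (+-suc fuel s))) (+-monoʳ-≤ fuel (m≤n+m (suc s) 3)))
  ... | bs , drop≡ , pats = (o , p) ∷ bs , ≡-trans drop≡′ (cong (map (o +_) p ++_) drop≡) , pat ∷ pats
    where
    ∣p∣+s≤∣π∣ : length p + s ≤ length π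
    ∣p∣+s≤∣π∣ = subst₂ _≤_ (cong (_+ s) (sym (Pattern-length pat))) (sym length≡) 3+s<n
    drop≡′ : drop s π ≡ map (o +_) p ++ drop (4 + s) π
    drop≡′ = subst (λ m → drop s π ≡ map (o +_) p ++ drop (m + s) π) (Pattern-length pat)
               (drop-shifted π p (λ j< → block (subst (_ <_) (Pattern-length pat) j<)) ∣p∣+s≤∣π∣)

  tiles : ∃[ bs ] π ≡ concat (map shifted bs) × All (Pattern ∘′ proj₂) bs
  tiles = tiling n z≤n (≤-reflexive (sym (+-identityʳ n))) (λ ()) (λ ())

-- The offsets of the blocks are 4 π′

window : ℕ → List ℕ
window o = map (o +_) (upTo 4)

upTo-+ : ∀ a b → upTo (a + b) ≡ upTo a ++ map (a +_) (upTo b)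
upTo-+ a zero    = ≡-trans (cong upTo (+-identityʳ a)) (sym (++-identityʳ (upTo a)))
upTo-+ a (suc b) = begin
  upTo (a + suc b)                                  ≡⟨ cong upTo (+-suc a b) ⟩
  upTo (suc (a + b))                                ≡⟨ sym (upTo-∷ʳ (a + b)) ⟩
  upTo (a + b) ++ [ a + b ]                         ≡⟨ cong (_++ [ a + b ]) (upTo-+ a b) ⟩
  (upTo a ++ map (a +_) (upTo b)) ++ [ a + b ]      ≡⟨ ++-assoc (upTo a) _ _ ⟩
  upTo a ++ map (a +_) (upTo b) ++ [ a + b ]        ≡⟨ cong (upTo a ++_) (sym (map-++ (a +_) (upTo b) [ b ])) ⟩
  upTo a ++ map (a +_) (upTo b ++ [ b ])            ≡⟨ cong (λ xs → upTo a ++ map (a +_) xs) (upTo-∷ʳ b) ⟩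
  upTo a ++ map (a +_) (upTo (suc b))               ∎
  where open ≡-Reasoning

++-cancelˡ-↭ : ∀ (xs : List ℕ) {ys zs} → xs ++ ys ↭ xs ++ zs → ys ↭ zs
++-cancelˡ-↭ []       p = p
++-cancelˡ-↭ (x ∷ xs) p = ++-cancelˡ-↭ xs (drop-∷ p)

concat-map-++ : ∀ (h : ℕ → List ℕ) xs ys → concat (map h (xs ++ ys)) ≡ concat (map h xs) ++ concat (map h ys)
concat-map-++ h xs ys = ≡-trans (cong concat (map-++ h xs ys)) (sym (concat-++ (map h xs) (map h ys)))

window-top : ∀ {m o} → m + 3 ∈ window o → o + 3 < m + 4 → o ≡ m
window-top {m} {o} m+3∈ o+3< with ∈-map⁻ (o +_) m+3∈
... | t , t∈ , m+3≡o+t =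
  ≤-antisym (+-cancelʳ-≤ 4 o m (subst (_≤ m + 4) (sym (+-suc o 3)) o+3<))
            (+-cancelʳ-≤ 3 m o (subst (_≤ o + 3) (sym m+3≡o+t) (+-monoʳ-≤ o (≤-pred (∈-upTo⁻ t∈)))))

-- The largest value m + 3 lies in some window, which must then be the topmost one.
top-window : ∀ m os → concat (map window os) ↭ upTo (m + 4) → m ∈ os
top-window m os p
  with ∈-concat⁻′ (map window os) (∈-resp-↭ (↭-sym p) (∈-upTo⁺ (+-monoʳ-< m (n<1+n 3))))
... | ws , m+3∈ws , ws∈ with ∈-map⁻ window ws∈
... | o , o∈os , refl =
  subst (_∈ os) (window-top m+3∈ws (∈-upTo⁻ (∈-resp-↭ p (∈-concat⁺′ o+3∈ (∈-map⁺ window o∈os))))) o∈os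
  where
  o+3∈ : o + 3 ∈ window o
  o+3∈ = ∈-map⁺ (o +_) (∈-upTo⁺ (n<1+n 3))

remove-window : ∀ m A B → concat (map window (A ++ m ∷ B)) ↭ upTo (m + 4) → concat (map window (A ++ B)) ↭ upTo m
remove-window m A B p = ++-cancelˡ-↭ (window m) (begin
  window m ++ concat (map window (A ++ B))                         ≡⟨ cong (window m ++_) (concat-map-++ window A B) ⟩
  window m ++ concat (map window A) ++ concat (map window B)       ↭⟨ shifts (window m) (concat (map window A)) ⟩
  concat (map window A) ++ window m ++ concat (map window B)       ≡⟨ sym (concat-map-++ window A (m ∷ B)) ⟩
  concat (map window (A ++ m ∷ B))                                 ↭⟨ p ⟩
  upTo (m + 4)                                                     ≡⟨ upTo-+ m 4 ⟩
  upTo m ++ window m                                               ↭⟨ ++-comm (upTo m) (window m) ⟩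
  window m ++ upTo m                                               ∎)
  where open PermutationReasoning

windows-↭⇒offsets : ∀ k os → length os ≡ k → concat (map window os) ↭ upTo (4 * k) → os ↭ map (4 *_) (upTo k)
windows-↭⇒offsets zero    []  _    _ = refl
windows-↭⇒offsets (suc k) os ∣os∣ p = split (∈-∃++ (top-window (4 * k) os p′))
  where
  p′ : concat (map window os) ↭ upTo (4 * k + 4)
  p′ = subst (λ z → concat (map window os) ↭ upTo z) (≡-trans (*-suc 4 k) (+-comm 4 (4 * k))) p
  split : ∃[ A ] ∃[ B ] os ≡ A ++ [ 4 * k ] ++ B → os ↭ map (4 *_) (upTo (suc k))
  split (A , B , os≡) = begin
    os                                      ≡⟨ os≡ ⟩
    A ++ [ 4 * k ] ++ B                     ↭⟨ shift (4 * k) A B ⟩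
    4 * k ∷ A ++ B                          ↭⟨ prep (4 * k) rest ⟩
    4 * k ∷ map (4 *_) (upTo k)             ↭⟨ ∷↭∷ʳ (4 * k) (map (4 *_) (upTo k)) ⟩
    map (4 *_) (upTo k) ++ map (4 *_) [ k ] ≡⟨ sym (map-++ (4 *_) (upTo k) [ k ]) ⟩
    map (4 *_) (upTo k ++ [ k ])            ≡⟨ cong (map (4 *_)) (upTo-∷ʳ k) ⟩
    map (4 *_) (upTo (suc k))               ∎
    where
    open PermutationReasoning
    ∣AB∣ : length (A ++ B) ≡ k
    ∣AB∣ = suc-injective (≡-trans (sym (length-++-sucʳ A (4 * k) B)) (≡-trans (cong length (sym os≡)) ∣os∣))
    rest : A ++ B ↭ map (4 *_) (upTo k)
    rest = windows-↭⇒offsets k (A ++ B) ∣AB∣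
             (remove-window (4 * k) A B (subst (λ xs → concat (map window xs) ↭ upTo (4 * k + 4)) os≡ p′))

shifted-↭-window : ∀ {o p} → Pattern p → shifted (o , p) ↭ window o
shifted-↭-window {o} pat = map⁺ (o +_) (Pattern-↭ pat)

concat-shifted-↭ : ∀ bs → All (Pattern ∘′ proj₂) bs → concat (map shifted bs) ↭ concat (map window (map proj₁ bs))
concat-shifted-↭ []       []           = refl
concat-shifted-↭ (b ∷ bs) (pat ∷ pats) = ++⁺ (shifted-↭-window pat) (concat-shifted-↭ bs pats)

length-concat-windows : ∀ os → length (concat (map window os)) ≡ 4 * length os
length-concat-windows []       = refl
length-concat-windows (o ∷ os) =
  ≡-trans (length-++ (window o) {concat (map window os)})
          (≡-trans (cong (4 +_) (length-concat-windows os)) (sym (*-suc 4 (length os))))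

offset-uniform : ∀ vs αs v → All (λ α → length α ≡ 4) αs → length vs ≡ length αs →
  offset vs αs v ≡ 4 * length (filter (_<? v) vs)
offset-uniform []       []       v _            _   = refl
offset-uniform (w ∷ vs) (α ∷ αs) v (∣α∣ ∷ ∣αs∣) ∣≡∣ with w <ᵇ v
... | true  = ≡-trans (cong₂ _+_ ∣α∣ (offset-uniform vs αs v ∣αs∣ (suc-injective ∣≡∣))) (sym (*-suc 4 _))
... | false = offset-uniform vs αs v ∣αs∣ (suc-injective ∣≡∣)

zipWith-map-map : ∀ {A B C D : Set} (h : B → C → D) (g₁ : A → B) (g₂ : A → C) xs →
  zipWith h (map g₁ xs) (map g₂ xs) ≡ map (λ x → h (g₁ x) (g₂ x)) xs
zipWith-map-map h g₁ g₂ []       = refl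
zipWith-map-map h g₁ g₂ (x ∷ xs) = cong (_ ∷_) (zipWith-map-map h g₁ g₂ xs)

4*j/4≡j : ∀ j → 4 * j / 4 ≡ j
4*j/4≡j j = ≡-trans (cong (_/ 4) (*-comm 4 j)) (m*n/n≡m j 4)

module Inflation {n π} (k : K n π) {bs : List (ℕ × List ℕ)} (π≡ : π ≡ concat (map shifted bs))
                 (pats : All (Pattern ∘′ proj₂) bs) where
  open KProperties k using (perm)

  os : List ℕ
  os = map proj₁ bs

  πs : List (List ℕ)
  πs = map proj₂ bs

  π′ : List ℕ
  π′ = map ((_/ 4) ∘′ proj₁) bs

  windows↭ : concat (map window os) ↭ upTo n
  windows↭ = trans (↭-sym (concat-shifted-↭ bs pats)) (subst (_↭ upTo n) π≡ perm)

  n≡4*∣bs∣ : n ≡ 4 * length bs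
  n≡4*∣bs∣ = begin
    n                                  ≡⟨ sym (length-upTo n) ⟩
    length (upTo n)                    ≡⟨ sym (↭-length windows↭) ⟩
    length (concat (map window os))    ≡⟨ length-concat-windows os ⟩
    4 * length os                      ≡⟨ cong (4 *_) (length-map proj₁ bs) ⟩
    4 * length bs                      ∎
    where open ≡-Reasoning

  os↭ : os ↭ map (4 *_) (upTo (length bs))
  os↭ = windows-↭⇒offsets (length bs) os (length-map proj₁ bs)
          (subst (λ m → concat (map window os) ↭ upTo m) n≡4*∣bs∣ windows↭)

  π′↭ : π′ ↭ upTo (length bs)
  π′↭ = subst₂ _↭_ (sym (map-∘ bs)) quarters (map⁺ (_/ 4) os↭)
    where
    quarters : map (_/ 4) (map (4 *_) (upTo (length bs))) ≡ upTo (length bs)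
    quarters = ≡-trans (sym (map-∘ (upTo (length bs)))) (map-id-local (tabulate λ {j} _ → 4*j/4≡j j))

  offset≡ : ∀ {b} → b ∈ bs → offset π′ πs (proj₁ b / 4) ≡ proj₁ b
  offset≡ {b} b∈ with ∈-map⁻ (4 *_) (∈-resp-↭ os↭ (∈-map⁺ proj₁ b∈))
  ... | j , j∈ , b₁≡4j = begin
    offset π′ πs (proj₁ b / 4)
      ≡⟨ cong (offset π′ πs) (≡-trans (cong (_/ 4) b₁≡4j) (4*j/4≡j j)) ⟩
    offset π′ πs j
      ≡⟨ offset-uniform π′ πs j (AllP.map⁺ (All.map Pattern-length pats))
                                (≡-trans (length-map _ bs) (sym (length-map proj₂ bs))) ⟩
    4 * length (filter (_<? j) π′)
      ≡⟨ cong (4 *_) (count-<-↭ j π′↭) ⟩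
    4 * length (filter (_<? j) (upTo (length bs)))
      ≡⟨ cong (λ xs → 4 * length xs) (filter-<-upTo-≤ (length bs) (<⇒≤ (∈-upTo⁻ j∈))) ⟩
    4 * length (upTo j)
      ≡⟨ cong (4 *_) (length-upTo j) ⟩
    4 * j
      ≡⟨ sym b₁≡4j ⟩
    proj₁ b
      ∎
    where open ≡-Reasoning

  inflate≡ : inflate π′ πs ≡ π
  inflate≡ = begin
    inflate π′ πs
      ≡⟨ cong concat (zipWith-map-map _ _ proj₂ bs) ⟩
    concat (map (λ b → map (offset π′ πs (proj₁ b / 4) +_) (proj₂ b)) bs)
      ≡⟨ cong concat (map-cong-local (tabulate λ b∈ → cong (λ o → map (o +_) _) (offset≡ b∈))) ⟩
    concat (map shifted bs)
      ≡⟨ sym π≡ ⟩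
    π
      ∎
    where open ≡-Reasoning

  cond1 : Cond1 π
  cond1 = length bs , πs , π′ , length-map proj₂ bs , AllP.map⁺ pats , length-map _ bs ,
          subst (λ m → π′ ↭ upTo m) (sym (length-map _ bs)) π′↭ , sym inflate≡

cond3⇒cond1 : ∀ {n π} → K n π → Cond3 n π → Cond1 π
cond3⇒cond1 k noPrince with Tiling.tiles k noPrince
... | _ , π≡ , pats = Inflation.cond1 k π≡ pats

mainTheorem8 : (n : ℕ) → 4 ≤ n → (π : List ℕ) → K n π →
    (Cond1 π ⇔ Cond2 n π) × (Cond1 π ⇔ Cond3 n π)
mainTheorem8 n 4≤n π k = mk⇔ (cond1⇒cond2 k) (cond3⇒cond1 k ∘′ cond2⇒cond3 1≤n k) ,
                         mk⇔ (cond2⇒cond3 1≤n k ∘′ cond1⇒cond2 k) (cond3⇒cond1 k)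
  where
  1≤n : 1 ≤ n
  1≤n = ≤-trans (s≤s z≤n) 4≤n
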